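{- Let $D=(V,A)$ be a digraph with a subdigraph $Q$ that has a good pair. Let $X=N_D^-(Q)$ and $Y=N_D^+(Q)$, and suppose $X\cap Y=\emptyset$ and $X\cup Y=V\setminus V(Q)$. Let $X_1,\dots,X_a$ be the initial strong components of $D[X]$ and $Y_1,\dots,Y_b$ the terminal strong components of $D[Y]$ (in some order). If one of the following holds, then $D$ has a good pair: (1) $d_Y^-(X_1)\ge 1$, $d_Y^-(X_i)\ge 2$ for all $i\in\{2,\dots,a\}$, and $d_X^+(Y_j)\ge 2$ for all $j\in\{1,\dots,b\}$; (2) $d_X^+(Y_1)\ge 1$, $d_X^+(Y_j)\ge 2$ for all $j\in\{2,\dots,b\}$, and $d_Y^-(X_i)\ge 2$ for all $i\in\{1,\dots,a\}$.
   Context: Digraphs have no loops and no multiple arcs. A good pair of a digraph is an arc-disjoint pair consisting of an out-branching and an in-branching (spanning trees of the underlying graph oriented so that every vertex but the root has in-degree, respectively out-degree, one). For a subdigraph $Q$ of $D$, $N_D^-(Q)$ ($N_D^+(Q)$) is the set of vertices outside $V(Q)$ having an arc to (from) some vertex of $Q$. $D[S]$ is the subdigraph induced by $S$. An initial (terminal) strong component of a digraph is a strong component with no arc entering (leaving) it from (to) other strong components. For disjoint vertex sets $S,T$, $N_T^-(S)$ is the set of vertices in $T$ with an arc to a vertex of $S$ and $d_T^-(S)=|N_T^-(S)|$; analogously $N_T^+(S)$ is the set of vertices in $T$ having an arc from a vertex of $S$ and $d_T^+(S)=|N_T^+(S)|$. -}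

module Defs where

open import Data.Nat using (ℕ; _≥_)
open import Data.Bool using (Bool; true; false; _∧_; not)
open import Data.Fin using (Fin)
open import Data.List using (List)
open import Data.Bool.ListAction using (any)
open import Data.Vec using (tabulate)
import Data.Fin.Subset as Sub
open import Data.Product using (Σ; _×_; ∃)
open import Relation.Binary.PropositionalEquality using (_≡_; _≢_)
open import Relation.Nullary using (¬_)
import Data.List as L

-- A digraph on vertex set Fin n, arcs given by a Boolean adjacency
-- relation (so no multiple arcs), with no loops.
record Digraph : Set where
  field
    n        : ℕ
    arc      : Fin n → Fin n → Bool
    loopless : ∀ v → arc v v ≡ false
open Digraph public

VSet : ℕ → Set
VSet n = Fin n → Bool

ASet : ℕ → Set
ASet n = Fin n → Fin n → Bool

allV : (n : ℕ) → List (Fin n)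
allV n = L.allFin n

size : {n : ℕ} → VSet n → ℕ
size {n} P = Sub.∣ tabulate P ∣

record Subdigraph (D : Digraph) : Set where
  field
    vQ    : VSet (n D)
    aQ    : ASet (n D)
    aQ⊆   : ∀ u v → aQ u v ≡ true → arc D u v ≡ true
    aQ-ends : ∀ u v → aQ u v ≡ true → (vQ u ≡ true) × (vQ v ≡ true)
open Subdigraph public

data Reach {n : ℕ} (B : ASet n) : Fin n → Fin n → Set where
  here : ∀ {v} → Reach B v v
  step : ∀ {u w v} → B u w ≡ true → Reach B w v → Reach B u v

rev : {n : ℕ} → ASet n → ASet n
rev B u v = B v u

record OutBranching {n : ℕ} (S : VSet n) (B : ASet n) (T : ASet n) : Set where
  field
    T⊆B     : ∀ u v → T u v ≡ true → B u v ≡ true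
    root    : Fin n
    root∈   : S root ≡ true
    rootIn0 : ∀ u → T u root ≡ false
    in1     : ∀ v → S v ≡ true → v ≢ root →
              Σ (Fin n) λ u → (T u v ≡ true) × (∀ u' → T u' v ≡ true → u' ≡ u)
    reach   : ∀ v → S v ≡ true → Reach T root v

InBranching : {n : ℕ} → VSet n → ASet n → ASet n → Set
InBranching S B T = OutBranching S (rev B) (rev T)

HasGoodPair : {n : ℕ} → VSet n → ASet n → Set
HasGoodPair {n} S B =
  Σ (ASet n) λ T⁺ → Σ (ASet n) λ T⁻ →
    OutBranching S B T⁺ × InBranching S B T⁻ ×
    (∀ u v → T⁺ u v ≡ true → T⁻ u v ≡ false)

allVertices : {n : ℕ} → VSet n
allVertices _ = true

DigraphHasGoodPair : Digraph → Set
DigraphHasGoodPair D = HasGoodPair allVertices (arc D)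

SubdigraphHasGoodPair : {D : Digraph} → Subdigraph D → Set
SubdigraphHasGoodPair Q = HasGoodPair (vQ Q) (aQ Q)

Nin : (D : Digraph) → VSet (n D) → VSet (n D)
Nin D P v = not (P v) ∧ any (λ q → P q ∧ arc D v q) (allV (n D))

Nout : (D : Digraph) → VSet (n D) → VSet (n D)
Nout D P v = not (P v) ∧ any (λ q → P q ∧ arc D q v) (allV (n D))

NinT : (D : Digraph) → VSet (n D) → VSet (n D) → VSet (n D)
NinT D T S v = T v ∧ any (λ s → S s ∧ arc D v s) (allV (n D))

NoutT : (D : Digraph) → VSet (n D) → VSet (n D) → VSet (n D)
NoutT D T S v = T v ∧ any (λ s → S s ∧ arc D s v) (allV (n D))

din : (D : Digraph) → VSet (n D) → VSet (n D) → ℕ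
din D T S = size (NinT D T S)

dout : (D : Digraph) → VSet (n D) → VSet (n D) → ℕ
dout D T S = size (NoutT D T S)

induced : (D : Digraph) → VSet (n D) → ASet (n D)
induced D S u v = S u ∧ S v ∧ arc D u v

record StrongComponent (D : Digraph) (S C : VSet (n D)) : Set where
  field
    C⊆S      : ∀ v → C v ≡ true → S v ≡ true
    nonempty : Σ (Fin (n D)) λ v → C v ≡ true
    strong   : ∀ u v → C u ≡ true → C v ≡ true → Reach (induced D S) u v
    maximal  : ∀ u w → C u ≡ true → S w ≡ true →
               Reach (induced D S) u w → Reach (induced D S) w u → C w ≡ true

InitialSC : (D : Digraph) (S C : VSet (n D)) → Set
InitialSC D S C = StrongComponent D S C ×
  (∀ u v → S u ≡ true → C u ≡ false → C v ≡ true → arc D u v ≡ false)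

TerminalSC : (D : Digraph) (S C : VSet (n D)) → Set
TerminalSC D S C = StrongComponent D S C ×
  (∀ u v → C u ≡ true → S v ≡ true → C v ≡ false → arc D u v ≡ false)

SameSet : {n : ℕ} → VSet n → VSet n → Set
SameSet P R = ∀ v → P v ≡ R v

-- Let T⁺Q, T⁻Q be a good pair of Q, rooted at r⁺ and r⁻. Every initial strong component of D[X]
-- and every terminal strong component of D[Y] gets its own arc from Y to X: one entering, resp.
-- leaving, that component. In the multigraph whose vertices are these components and whose edges
-- are the arcs from Y to X, the degree conditions say that all vertices but at most one have
-- degree at least two and that one has degree at least one, and then a walk through the multigraph
-- assigns distinct edges to all vertices. The arcs assigned to components of D[Y], T⁻Q, the arcs
-- from X to Q and the arcs of D[Y] form a subdigraph A⁻ in which every vertex reaches r⁻; the other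
-- arcs from Y to X, T⁺Q, the arcs from Q to Y and the arcs of D[X] form an arc-disjoint subdigraph
-- A⁺ in which r⁺ reaches every vertex. Spanning branchings of A⁺ and A⁻ are a good pair of D.

module Submission where

open import Defs
open import Data.Nat using (ℕ; zero; suc; _≤_; _<_; _≥_; z≤n; s≤s)
open import Data.Nat.Properties using (≤-trans; <-≤-trans; ≤-pred; ≤-reflexive; n≮n; n≮0)
open import Data.Bool using (Bool; true; false; _∧_; _∨_; not; if_then_else_)
import Data.Bool as Bool
open import Data.Bool.Properties using (∧-conicalˡ; ∧-conicalʳ; ∧-zeroʳ; T-≡)
open import Data.Bool.ListAction using (any)
open import Data.List using (List)
open import Data.List.Relation.Unary.Any using (satisfied)
open import Data.List.Relation.Unary.Any.Properties using (any⁻)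
open import Function.Bundles using (Equivalence)
open import Data.Fin using (Fin; zero; suc)
open import Data.Fin.Properties using (_≟_; any?)
open import Data.Fin.Subset using (_∈_; ⁅_⁆; ∣_∣)
open import Data.Fin.Subset.Properties
  using (p⊆q⇒∣p∣≤∣q∣; p⊂q⇒∣p∣<∣q∣; ∣p∣≤n; nonempty?; Empty-unique; ∣⊥∣≡0; x∈⁅x⁆; ∣⁅x⁆∣≡1)
open import Data.Vec using (tabulate)
open import Data.Vec.Properties using (lookup∘tabulate; []=⇒lookup; lookup⇒[]=)
open import Data.Product using (Σ; ∃; ∃₂; _×_; _,_; proj₁; proj₂; swap; map₂)
import Data.Product.Properties as Productₚ
open import Data.Sum using (_⊎_; inj₁; inj₂; [_,_]; [_,_]′)
open import Data.Empty using (⊥-elim)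
open import Data.Maybe using (Maybe; just; nothing)
import Data.Maybe as Maybe
open import Data.Maybe.Properties using (just-injective)
import Data.Maybe.Properties as Maybeₚ
open import Function using (_∘_)
open import Relation.Nullary using (¬_; Dec; yes; no; does; ¬?; _×-dec_; _⊎-dec_)
open import Relation.Nullary.Decidable using (dec-true; dec-false)
open import Relation.Binary.PropositionalEquality hiding ([_])

private variable
  m : ℕ

-- Boolean vertex sets

∧-intro : ∀ {a b} → a ≡ true → b ≡ true → a ∧ b ≡ true
∧-intro refl refl = refl

∧-elimˡ : ∀ {a b} → a ∧ b ≡ true → a ≡ true
∧-elimˡ {a} {b} = ∧-conicalˡ a b

∧-elimʳ : ∀ {a b} → a ∧ b ≡ true → b ≡ true
∧-elimʳ {a} {b} = ∧-conicalʳ a b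

∧₃-elim : ∀ a b {c} → a ∧ (b ∧ c) ≡ true → a ≡ true × b ≡ true × c ≡ true
∧₃-elim true true h = refl , refl , h

∨-introˡ : ∀ {a} b → a ≡ true → a ∨ b ≡ true
∨-introˡ b refl = refl

∨-introʳ : ∀ a {b} → b ≡ true → a ∨ b ≡ true
∨-introʳ true  _ = refl
∨-introʳ false p = p

∨-elim : ∀ {a b} → a ∨ b ≡ true → a ≡ true ⊎ b ≡ true
∨-elim {true}  _ = inj₁ refl
∨-elim {false} p = inj₂ p

not-true : ∀ {a} → not a ≡ true → a ≡ false
not-true {false} _ = refl

not-false : ∀ {a} → a ≡ false → not a ≡ true
not-false refl = refl

true≢false : ∀ {a} → a ≡ true → a ≢ false
true≢false refl ()

bool-cases : ∀ a → a ≡ true ⊎ a ≡ false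
bool-cases true  = inj₁ refl
bool-cases false = inj₂ refl

infix 4 _≟true
_≟true : (a : Bool) → Dec (a ≡ true)
a ≟true = a Bool.≟ true

does-sound : ∀ {p} {P : Set p} (P? : Dec P) → does P? ≡ true → P
does-sound (yes p) _ = p

does-refute : ∀ {p} {P : Set p} (P? : Dec P) → does P? ≡ false → ¬ P
does-refute (no ¬p) _ = ¬p

bool-ext : ∀ {a b} → (a ≡ true → b ≡ true) → (b ≡ true → a ≡ true) → a ≡ b
bool-ext {true}          a⇒b _   = sym (a⇒b refl)
bool-ext {false} {true}  _   b⇒a = b⇒a refl
bool-ext {false} {false} _   _   = refl

_==_ : Fin m → Fin m → Bool
a == b = does (a ≟ b)

_⊆ᵇ_ : VSet m → VSet m → Set
P ⊆ᵇ R = ∀ v → P v ≡ true → R v ≡ true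

∈-tabulate⁺ : {P : VSet m} {v : Fin m} → P v ≡ true → v ∈ tabulate P
∈-tabulate⁺ {P = P} {v} h = lookup⇒[]= v (tabulate P) (trans (lookup∘tabulate P v) h)

∈-tabulate⁻ : {P : VSet m} {v : Fin m} → v ∈ tabulate P → P v ≡ true
∈-tabulate⁻ {P = P} {v} h = trans (sym (lookup∘tabulate P v)) ([]=⇒lookup h)

size-strict : {P R : VSet m} → P ⊆ᵇ R → ∀ v → P v ≡ false → R v ≡ true → size P < size R
size-strict {P = P} {R} P⊆R v Pv Rv =
  p⊂q⇒∣p∣<∣q∣ {p = tabulate P} {q = tabulate R}
    ((λ h → ∈-tabulate⁺ (P⊆R _ (∈-tabulate⁻ h))) , v , ∈-tabulate⁺ Rv , λ h → true≢false (∈-tabulate⁻ h) Pv)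

size≤ : (P : VSet m) → size P ≤ m
size≤ P = ∣p∣≤n (tabulate P)

size-nonempty : (P : VSet m) → 1 ≤ size P → ∃ λ v → P v ≡ true
size-nonempty {m} P h with nonempty? (tabulate P)
... | yes (v , v∈P) = v , ∈-tabulate⁻ v∈P
... | no empty = ⊥-elim (n≮n 0 (≤-trans h (≤-reflexive (trans (cong ∣_∣ (Empty-unique empty)) (∣⊥∣≡0 m)))))

size-twoElements : (P : VSet m) → 2 ≤ size P → ∃₂ λ u v → u ≢ v × P u ≡ true × P v ≡ true
size-twoElements {m} P h with size-nonempty P (≤-trans (s≤s z≤n) h)
... | u , Pu with any? (λ v → P v ≟true ×-dec ¬? (v ≟ u))
...   | yes (v , Pv , v≢u) = u , v , (λ u≡v → v≢u (sym u≡v)) , Pu , Pv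
...   | no none = ⊥-elim (n≮n 1 (≤-trans h (≤-trans P≤1 (≤-reflexive (∣⁅x⁆∣≡1 u)))))
  where
  P⊆⁅u⁆ : ∀ {v} → v ∈ tabulate P → v ∈ ⁅ u ⁆
  P⊆⁅u⁆ {v} v∈P with v ≟ u
  ... | yes refl = x∈⁅x⁆ u
  ... | no v≢u   = ⊥-elim (none (v , ∈-tabulate⁻ v∈P , v≢u))

  P≤1 : size P ≤ ∣ ⁅ u ⁆ ∣
  P≤1 = p⊆q⇒∣p∣≤∣q∣ {p = tabulate P} {q = ⁅ u ⁆} P⊆⁅u⁆

insert : VSet m → Fin m → VSet m
insert W b v = W v ∨ (v == b)

insert-new : (W : VSet m) (b : Fin m) → insert W b b ≡ true
insert-new W b = ∨-introʳ (W b) (dec-true (b ≟ b) refl)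

insert-old : (W : VSet m) (b : Fin m) {v : Fin m} → W v ≡ true → insert W b v ≡ true
insert-old W b h = ∨-introˡ _ h

insert-cases : (W : VSet m) (b : Fin m) {v : Fin m} → insert W b v ≡ true → W v ≡ true ⊎ v ≡ b
insert-cases W b {v} h with ∨-elim {W v} h
... | inj₁ Wv = inj₁ Wv
... | inj₂ v=b = inj₂ (does-sound (v ≟ b) v=b)

_∖_ : VSet m → VSet m → VSet m
(R ∖ W) v = R v ∧ not (W v)

size-insert : (R W : VSet m) {b : Fin m} → R b ≡ true → W b ≡ false → size (R ∖ insert W b) < size (R ∖ W)
size-insert R W {b} Rb Wb =
  size-strict shrink b (trans (cong (λ x → R b ∧ not x) (insert-new W b)) (∧-zeroʳ (R b))) (∧-intro Rb (not-false Wb))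
  where
  shrink : (R ∖ insert W b) ⊆ᵇ (R ∖ W)
  shrink v h with bool-cases (W v)
  ... | inj₂ Wv = ∧-intro (∧-elimˡ h) (not-false Wv)
  ... | inj₁ Wv = ⊥-elim (true≢false (insert-old W b Wv) (not-true (∧-elimʳ {R v} h)))

update : ∀ {a} {A : Set a} → (Fin m → A) → Fin m → A → Fin m → A
update f b x v = if v == b then x else f v

update-here : ∀ {a} {A : Set a} (f : Fin m → A) b x → update f b x b ≡ x
update-here f b x rewrite dec-true (b ≟ b) refl = refl

update-there : ∀ {a} {A : Set a} (f : Fin m → A) {b} x {v} → v ≢ b → update f b x v ≡ f v
update-there f {b} x {v} v≢b rewrite dec-false (v ≟ b) v≢b = refl

first : VSet m → Maybe (Fin m)
first {zero}  P = nothing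
first {suc m} P = if P zero then just zero else Maybe.map suc (first (P ∘ suc))

first-cong : {P R : VSet m} → SameSet P R → first P ≡ first R
first-cong {zero}          P=R = refl
first-cong {suc m} {P} {R} P=R rewrite P=R zero | first-cong {P = P ∘ suc} {R ∘ suc} (P=R ∘ suc) = refl

first-∈ : (P : VSet m) {i : Fin m} → first P ≡ just i → P i ≡ true
first-∈ {suc m} P h with P zero in P0
first-∈ {suc m} P refl | true  = P0
first-∈ {suc m} P h    | false with first (P ∘ suc) in eq
first-∈ {suc m} P refl | false | just j = first-∈ (P ∘ suc) eq

first-nonempty : (P : VSet m) {v : Fin m} → P v ≡ true → ∃ λ i → first P ≡ just i
first-nonempty {suc m} P {v} Pv with P zero in P0
... | true = zero , refl
first-nonempty {suc m} P {zero}  Pv | false = ⊥-elim (true≢false Pv P0)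
first-nonempty {suc m} P {suc v} Pv | false with first-nonempty (P ∘ suc) Pv
... | i , eq rewrite eq = suc i , refl

-- Reachability and branchings

reach-trans : {B : ASet m} {u v w : Fin m} → Reach B u v → Reach B v w → Reach B u w
reach-trans here        q = q
reach-trans (step uw p) q = step uw (reach-trans p q)

reach-snoc : {B : ASet m} {u v w : Fin m} → Reach B u v → B v w ≡ true → Reach B u w
reach-snoc p vw = reach-trans p (step vw here)

reach-rev : {B : ASet m} {u v : Fin m} → Reach B u v → Reach (rev B) v u
reach-rev here        = here
reach-rev (step uw p) = reach-snoc (reach-rev p) uw

reach-mono : {B B′ : ASet m} → (∀ a b → B a b ≡ true → B′ a b ≡ true) →
             {u v : Fin m} → Reach B u v → Reach B′ u v
reach-mono B⊆B′ here        = here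
reach-mono B⊆B′ (step uw p) = step (B⊆B′ _ _ uw) (reach-mono B⊆B′ p)

Closed : ASet m → VSet m → Set
Closed B W = ∀ a b → W a ≡ true → B a b ≡ true → W b ≡ true

reach-closed : {B : ASet m} {W : VSet m} → Closed B W → {u v : Fin m} → Reach B u v → W u ≡ true → W v ≡ true
reach-closed closed here        Wu = Wu
reach-closed closed (step uw p) Wu = reach-closed closed p (closed _ _ Wu uw)

module SearchTree {m : ℕ} (B : ASet m) (r : Fin m) where

  treeArcs : VSet m → (Fin m → Fin m) → ASet m
  treeArcs W parent a b = W b ∧ (not (b == r) ∧ (parent b == a))

  record PartialTree (W : VSet m) (parent : Fin m → Fin m) : Set where
    field
      root∈      : W r ≡ true
      parent-arc : ∀ w → W w ≡ true → w ≢ r → B (parent w) w ≡ true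
      spans      : ∀ w → W w ≡ true → Reach (treeArcs W parent) r w
  open PartialTree

  record ClosedTree : Set where
    field
      W       : VSet m
      parent  : Fin m → Fin m
      tree    : PartialTree W parent
      closed  : Closed B W

  crossing : VSet m → ASet m
  crossing W a b = W a ∧ (not (W b) ∧ B a b)

  attach : ∀ {W parent a b} → PartialTree W parent → crossing W a b ≡ true →
           PartialTree (insert W b) (update parent b a)
  attach {W} {parent} {a} {b} t h = record
    { root∈      = insert-old W b (root∈ t)
    ; parent-arc = parent-arc′
    ; spans      = spans′ }
    where
    Wa : W a ≡ true
    Wa = ∧-elimˡ h

    ¬Wb : W b ≡ false
    ¬Wb = not-true (∧-elimˡ (∧-elimʳ {W a} h))

    b≢r : b ≢ r
    b≢r refl = true≢false (root∈ t) ¬Wb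

    old : ∀ {v} → W v ≡ true → update parent b a v ≡ parent v
    old {v} Wv = update-there parent a λ { refl → true≢false Wv ¬Wb }

    grown : ∀ u v → treeArcs W parent u v ≡ true → treeArcs (insert W b) (update parent b a) u v ≡ true
    grown u v h rewrite old (∧-elimˡ h) = ∧-intro (insert-old W b (∧-elimˡ h)) (∧-elimʳ {W v} h)

    parent-arc′ : ∀ w → insert W b w ≡ true → w ≢ r → B (update parent b a w) w ≡ true
    parent-arc′ w h′ w≢r with insert-cases W b h′
    ... | inj₁ Ww   rewrite old Ww = parent-arc t w Ww w≢r
    ... | inj₂ refl rewrite update-here parent b a = ∧-elimʳ (∧-elimʳ {W a} h)

    new-arc : treeArcs (insert W b) (update parent b a) a b ≡ true
    new-arc rewrite update-here parent b a | dec-false (b ≟ r) b≢r | dec-true (a ≟ a) refl =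
      ∧-intro (insert-new W b) refl

    spans′ : ∀ w → insert W b w ≡ true → Reach (treeArcs (insert W b) (update parent b a)) r w
    spans′ w h′ with insert-cases W b h′
    ... | inj₁ Ww   = reach-mono grown (spans t w Ww)
    ... | inj₂ refl = reach-snoc (reach-mono grown (spans t a Wa)) new-arc

  fewer-outside : ∀ {W a b} → crossing W a b ≡ true → size (allVertices ∖ insert W b) < size (allVertices ∖ W)
  fewer-outside {W} {a} h = size-insert allVertices W refl (not-true (∧-elimˡ (∧-elimʳ {W a} h)))

  grow : ∀ k W parent → PartialTree W parent → size (allVertices ∖ W) ≤ k → ClosedTree
  grow k W parent t bound with any? (λ a → any? (λ b → crossing W a b ≟true))
  grow k       W parent t bound | no none = record { W = W ; parent = parent ; tree = t ; closed = closed }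
    where
    closed : Closed B W
    closed a b Wa ab with bool-cases (W b)
    ... | inj₁ Wb  = Wb
    ... | inj₂ ¬Wb = ⊥-elim (none (a , b , ∧-intro Wa (∧-intro (not-false ¬Wb) ab)))
  grow zero    W parent t bound | yes (a , b , h) = ⊥-elim (n≮0 (<-≤-trans (fewer-outside h) bound))
  grow (suc k) W parent t bound | yes (a , b , h) =
    grow k (insert W b) (update parent b a) (attach t h) (≤-pred (<-≤-trans (fewer-outside h) bound))

  closedTree : ClosedTree
  closedTree = grow m (_== r) (λ v → v) rootOnly (size≤ _)
    where
    rootOnly : PartialTree (_== r) (λ v → v)
    rootOnly = record
      { root∈      = dec-true (r ≟ r) refl
      ; parent-arc = λ w h w≢r → ⊥-elim (w≢r (does-sound (w ≟ r) h))
      ; spans      = λ w h → subst (Reach _ r) (sym (does-sound (w ≟ r) h)) here }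

  open ClosedTree closedTree

  treeArcs⊆B : ∀ a b → treeArcs W parent a b ≡ true → B a b ≡ true
  treeArcs⊆B a b h with does-sound (parent b ≟ a) (∧-elimʳ (∧-elimʳ {W b} h))
  ... | refl = parent-arc tree b (∧-elimˡ h) λ { refl →
                 true≢false (dec-true (b ≟ b) refl) (not-true (∧-elimˡ (∧-elimʳ {W b} h))) }

  reachable : VSet m
  reachable = W

  reachable-sound : ∀ v → reachable v ≡ true → Reach B r v
  reachable-sound v h = reach-mono treeArcs⊆B (spans tree v h)

  reachable-complete : ∀ v → Reach B r v → reachable v ≡ true
  reachable-complete v p = reach-closed closed p (root∈ tree)

  outBranching : (∀ v → Reach B r v) → Σ (ASet m) (OutBranching allVertices B)
  outBranching reachesAll = treeArcs W parent , record
    { T⊆B     = treeArcs⊆B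
    ; root    = r
    ; root∈   = refl
    ; rootIn0 = rootIn0
    ; in1     = λ v _ v≢r → parent v , from-parent v≢r , to-parent
    ; reach   = λ v _ → spans tree v (all v) }
    where
    all : ∀ v → W v ≡ true
    all v = reachable-complete v (reachesAll v)

    rootIn0 : ∀ u → treeArcs W parent u r ≡ false
    rootIn0 u rewrite all r | dec-true (r ≟ r) refl = refl

    from-parent : ∀ {v} → v ≢ r → treeArcs W parent (parent v) v ≡ true
    from-parent {v} v≢r rewrite all v | dec-false (v ≟ r) v≢r | dec-true (parent v ≟ parent v) refl = refl

    to-parent : ∀ {v} u → treeArcs W parent u v ≡ true → u ≡ parent v
    to-parent {v} u h = sym (does-sound (parent v ≟ u) (∧-elimʳ (∧-elimʳ {W v} h)))

outBranching-mono : {S : VSet m} {B B′ T : ASet m} → (∀ u v → B u v ≡ true → B′ u v ≡ true) →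
                    OutBranching S B T → OutBranching S B′ T
outBranching-mono B⊆B′ ob = record
  { T⊆B = λ u v h → B⊆B′ u v (T⊆B u v h)
  ; root = root ; root∈ = root∈ ; rootIn0 = rootIn0 ; in1 = in1 ; reach = reach }
  where open OutBranching ob

arcDisjointReach⇒goodPair : {B : ASet m} (A⁺ A⁻ : ASet m) {r⁺ r⁻ : Fin m} →
              (∀ u v → A⁺ u v ≡ true → B u v ≡ true) → (∀ u v → A⁻ u v ≡ true → B u v ≡ true) →
              (∀ u v → A⁺ u v ≡ true → A⁻ u v ≢ true) →
              (∀ v → Reach A⁺ r⁺ v) → (∀ v → Reach A⁻ v r⁻) → HasGoodPair allVertices B
arcDisjointReach⇒goodPair A⁺ A⁻ {r⁺} {r⁻} A⁺⊆B A⁻⊆B disjoint from-r⁺ to-r⁻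
  with SearchTree.outBranching A⁺ r⁺ from-r⁺ | SearchTree.outBranching (rev A⁻) r⁻ (λ v → reach-rev (to-r⁻ v))
... | T⁺ , out | T⁻ , in′ =
  T⁺ , rev T⁻ , outBranching-mono A⁺⊆B out , outBranching-mono (λ u v → A⁻⊆B v u) in′ , arc-disjoint
  where
  arc-disjoint : ∀ u v → T⁺ u v ≡ true → T⁻ v u ≡ false
  arc-disjoint u v h with bool-cases (T⁻ v u)
  ... | inj₂ ¬h = ¬h
  ... | inj₁ h′ = ⊥-elim (disjoint u v (OutBranching.T⊆B out u v h) (OutBranching.T⊆B in′ v u h′))

-- Strong components

reverse : Digraph → Digraph
reverse D = record { n = n D ; arc = λ u v → arc D v u ; loopless = loopless D }

reach-reverse : (D : Digraph) (S : VSet (n D)) {u v : Fin (n D)} →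
                Reach (induced D S) u v → Reach (induced (reverse D) S) v u
reach-reverse D S p = reach-mono flip (reach-rev p)
  where
  flip : ∀ a b → rev (induced D S) a b ≡ true → induced (reverse D) S a b ≡ true
  flip a b h = let Sb , Sa , ba = ∧₃-elim (S b) (S a) h in ∧-intro Sa (∧-intro Sb ba)

strongComponent-reverse : (D : Digraph) (S : VSet (n D)) {C : VSet (n D)} →
                          StrongComponent D S C → StrongComponent (reverse D) S C
strongComponent-reverse D S sc = record
  { C⊆S      = C⊆S
  ; nonempty = nonempty
  ; strong   = λ u v Cu Cv → reach-reverse D S (strong v u Cv Cu)
  ; maximal  = λ u w Cu Sw p q → maximal u w Cu Sw (reach-reverse (reverse D) S q) (reach-reverse (reverse D) S p) }
  where open StrongComponent sc

terminal⇒initial-reverse : (D : Digraph) (S : VSet (n D)) {C : VSet (n D)} →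
                           TerminalSC D S C → InitialSC (reverse D) S C
terminal⇒initial-reverse D S (sc , noArcLeaves) =
  strongComponent-reverse D S sc , λ u v Su Cu Cv → noArcLeaves v u Cv Su Cu

initial-reverse⇒terminal : (D : Digraph) (S : VSet (n D)) {C : VSet (n D)} →
                           InitialSC (reverse D) S C → TerminalSC D S C
initial-reverse⇒terminal D S (sc , noArcEnters) =
  strongComponent-reverse (reverse D) S sc , λ u v Cu Sv Cv → noArcEnters v u Sv Cv Cu

module Components (D : Digraph) (S : VSet (n D)) where

  private
    V : Set
    V = Fin (n D)

  _⇝_ : V → V → Bool
  u ⇝ v = SearchTree.reachable (induced D S) u v

  ⇝-sound : ∀ {u v} → u ⇝ v ≡ true → Reach (induced D S) u v
  ⇝-sound {u} {v} = SearchTree.reachable-sound (induced D S) u v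

  ⇝-complete : ∀ {u v} → Reach (induced D S) u v → u ⇝ v ≡ true
  ⇝-complete {u} {v} = SearchTree.reachable-complete (induced D S) u v

  comp : V → VSet (n D)
  comp a w = S w ∧ (a ⇝ w ∧ w ⇝ a)

  comp-reach : ∀ {a w} → comp a w ≡ true → Reach (induced D S) a w × Reach (induced D S) w a
  comp-reach {a} {w} h = let _ , aw , wa = ∧₃-elim (S w) (a ⇝ w) h in ⇝-sound aw , ⇝-sound wa

  comp-intro : ∀ {a w} → S w ≡ true → Reach (induced D S) a w → Reach (induced D S) w a → comp a w ≡ true
  comp-intro Sw p q = ∧-intro Sw (∧-intro (⇝-complete p) (⇝-complete q))

  comp-strong : ∀ {a} → S a ≡ true → StrongComponent D S (comp a)
  comp-strong {a} Sa = record
    { C⊆S      = λ w h → ∧-elimˡ h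
    ; nonempty = a , comp-intro Sa here here
    ; strong   = λ u v Cu Cv → reach-trans (proj₂ (comp-reach Cu)) (proj₁ (comp-reach Cv))
    ; maximal  = λ u w Cu Sw p q →
        comp-intro Sw (reach-trans (proj₁ (comp-reach Cu)) p) (reach-trans q (proj₂ (comp-reach Cu))) }

  comp-of : ∀ {C a} → StrongComponent D S C → C a ≡ true → SameSet (comp a) C
  comp-of {C} {a} sc Ca w = bool-ext
    (λ h → maximal a w Ca (∧-elimˡ h) (proj₁ (comp-reach h)) (proj₂ (comp-reach h)))
    (λ Cw → comp-intro (C⊆S w Cw) (strong a w Ca Cw) (strong w a Cw Ca))
    where open StrongComponent sc

  comp-cong : ∀ {a b} → S a ≡ true → comp a b ≡ true → SameSet (comp b) (comp a)
  comp-cong Sa ab = comp-of (comp-strong Sa) ab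

  entering : VSet (n D) → V → V → Bool
  entering C u v = S u ∧ (not (C u) ∧ (C v ∧ arc D u v))

  entering-parts : ∀ {C u v} → entering C u v ≡ true →
                   S u ≡ true × C u ≡ false × C v ≡ true × arc D u v ≡ true
  entering-parts {C} {u} {v} h =
    let Su , ¬Cu , Cv∧uv = ∧₃-elim (S u) (not (C u)) h
    in  Su , not-true ¬Cu , ∧-elimˡ {C v} Cv∧uv , ∧-elimʳ {C v} Cv∧uv

  arcEnters? : (C : VSet (n D)) → Dec (∃₂ λ u v → entering C u v ≡ true)
  arcEnters? C = any? (λ u → any? (λ v → entering C u v ≟true))

  NoArcEnters : VSet (n D) → Set
  NoArcEnters C = ∀ u v → S u ≡ true → C u ≡ false → C v ≡ true → arc D u v ≡ false

  noArcEnters : ∀ {C} → ¬ (∃₂ λ u v → entering C u v ≡ true) → NoArcEnters C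
  noArcEnters none u v Su Cu Cv with bool-cases (arc D u v)
  ... | inj₂ ¬uv = ¬uv
  ... | inj₁ uv  = ⊥-elim (none (u , v , ∧-intro Su (∧-intro (not-false Cu) (∧-intro Cv uv))))

  noEntering : ∀ {C C′} → SameSet C′ C → NoArcEnters C → ¬ (∃₂ λ u v → entering C′ u v ≡ true)
  noEntering same noIn (u , v , h) with entering-parts h
  ... | Su , C′u , C′v , uv = true≢false uv (noIn u v Su (trans (sym (same u)) C′u) (trans (sym (same v)) C′v))

  -- Initial components are represented by their first vertex.
  initialRep : VSet (n D)
  initialRep b = not (does (arcEnters? (comp b))) ∧ does (Maybeₚ.≡-dec _≟_ (first (comp b)) (just b))

  initialRep-first : ∀ {b} → initialRep b ≡ true → first (comp b) ≡ just b
  initialRep-first {b} h =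
    does-sound (Maybeₚ.≡-dec _≟_ (first (comp b)) (just b)) (∧-elimʳ {not (does (arcEnters? (comp b)))} h)

  initialRep-∈ : ∀ {b} → initialRep b ≡ true → S b ≡ true
  initialRep-∈ {b} h = ∧-elimˡ (first-∈ (comp b) (initialRep-first h))

  initialRep⇒initial : ∀ {b} → initialRep b ≡ true → InitialSC D S (comp b)
  initialRep⇒initial {b} h =
    comp-strong (initialRep-∈ h) , noArcEnters (does-refute (arcEnters? (comp b)) (not-true (∧-elimˡ h)))

  initialRep-unique : ∀ {a c x} → initialRep a ≡ true → initialRep c ≡ true →
                      comp a x ≡ true → comp c x ≡ true → a ≡ c
  initialRep-unique {a} {c} ra rc ax cx = just-injective (begin
    just a          ≡⟨ sym (initialRep-first ra) ⟩
    first (comp a)  ≡⟨ first-cong (λ w → sym (comp-cong (initialRep-∈ ra) ax w)) ⟩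
    first (comp _)  ≡⟨ first-cong (comp-cong (initialRep-∈ rc) cx) ⟩
    first (comp c)  ≡⟨ initialRep-first rc ⟩
    just c          ∎)
    where open ≡-Reasoning

  initialRep-sameSet : ∀ {a c} → initialRep a ≡ true → initialRep c ≡ true → SameSet (comp a) (comp c) → a ≡ c
  initialRep-sameSet {c = c} ra rc same = initialRep-unique ra rc (trans (same c) cc) cc
    where
    cc : comp c c ≡ true
    cc = comp-intro (initialRep-∈ rc) here here

  initialRep-of : ∀ {C} → InitialSC D S C → Σ V λ b → initialRep b ≡ true × SameSet (comp b) C
  initialRep-of {C} (sc , noIn) with StrongComponent.nonempty sc
  ... | v , Cv with first-nonempty (comp v) (comp-intro (StrongComponent.C⊆S sc v Cv) here here)
  ...   | b , first-v =
    b , ∧-intro (not-false (dec-false (arcEnters? (comp b)) (noEntering same noIn)))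
                (dec-true (Maybeₚ.≡-dec _≟_ (first (comp b)) (just b)) first-b)
      , same
    where
    Sv : S v ≡ true
    Sv = StrongComponent.C⊆S sc v Cv

    b=v : SameSet (comp b) (comp v)
    b=v = comp-cong Sv (first-∈ (comp v) first-v)

    same : SameSet (comp b) C
    same w = trans (b=v w) (comp-of sc Cv w)

    first-b : first (comp b) ≡ just b
    first-b = trans (first-cong b=v) first-v

  entering-reach : ∀ {a u v} → entering (comp a) u v ≡ true → Reach (induced D S) u a
  entering-reach {a} h with entering-parts {comp a} h
  ... | Su , _ , av , uv = step (∧-intro Su (∧-intro (∧-elimˡ av) uv)) (proj₂ (comp-reach av))

  entering-fewer : ∀ {a u v} → entering (comp a) u v ≡ true → size (_⇝ u) < size (_⇝ a)
  entering-fewer {a} {u} h =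
    size-strict (λ w w⇝u → ⇝-complete (reach-trans (⇝-sound w⇝u) (entering-reach h))) a a⇝̸u (⇝-complete here)
    where
    a⇝̸u : a ⇝ u ≡ false
    a⇝̸u with bool-cases (a ⇝ u)
    ... | inj₂ no-path = no-path
    ... | inj₁ path    = ⊥-elim (true≢false (comp-intro (proj₁ (entering-parts {comp a} h)) (⇝-sound path) (entering-reach h))
                                             (proj₁ (proj₂ (entering-parts {comp a} h))))

  reachedFromInitial : ∀ k {a} → S a ≡ true → size (_⇝ a) ≤ k →
                       Σ V λ c → InitialSC D S (comp c) × Reach (induced D S) c a
  reachedFromInitial k {a} Sa bound with arcEnters? (comp a)
  reachedFromInitial k       {a} Sa bound | no none = a , (comp-strong Sa , noArcEnters none) , here
  reachedFromInitial zero    {a} Sa bound | yes (u , v , h) = ⊥-elim (n≮0 (<-≤-trans (entering-fewer h) bound))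
  reachedFromInitial (suc k) {a} Sa bound | yes (u , v , h) =
    let c , initial , c⇝u = reachedFromInitial k (proj₁ (entering-parts {comp a} h))
                                                 (≤-pred (<-≤-trans (entering-fewer h) bound))
    in  c , initial , reach-trans c⇝u (entering-reach h)

  reachedFromInitialRep : ∀ {x} → S x ≡ true →
                          Σ V λ b → initialRep b ≡ true × (∀ z → comp b z ≡ true → Reach (induced D S) z x)
  reachedFromInitialRep Sx with reachedFromInitial (n D) Sx (size≤ _)
  ... | c , initial , c⇝x with initialRep-of initial
  ...   | b , rb , same = b , rb , λ z bz → reach-trans (proj₂ (comp-reach (trans (sym (same z)) bz))) c⇝x

-- Distinct representatives

record DistinctRepresentatives {m : ℕ} {E : Set} (W : VSet m) (inc : Fin m → E → Bool) (σ : Fin m → E) : Set where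
  field
    represents : ∀ a → W a ≡ true → inc a (σ a) ≡ true
    distinct   : ∀ a b → W a ≡ true → W b ≡ true → σ a ≡ σ b → a ≡ b
open DistinctRepresentatives

assign : ∀ {m} {E : Set} {W : VSet m} {inc : Fin m → E → Bool} {σ : Fin m → E} {c f} →
         DistinctRepresentatives W inc σ → W c ≡ false → inc c f ≡ true → (∀ a → W a ≡ true → σ a ≢ f) →
         DistinctRepresentatives (insert W c) inc (update σ c f)
assign {W = W} {inc} {σ} {c} {f} reps Wc cf fresh = record { represents = represents′ ; distinct = distinct′ }
  where
  old : ∀ {a} → W a ≡ true → update σ c f a ≡ σ a
  old Wa = update-there σ f λ { refl → true≢false Wa Wc }

  represents′ : ∀ a → insert W c a ≡ true → inc a (update σ c f a) ≡ true
  represents′ a h with insert-cases W c h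
  ... | inj₁ Wa   rewrite old Wa = represents reps a Wa
  ... | inj₂ refl rewrite update-here σ c f = cf

  distinct′ : ∀ a b → insert W c a ≡ true → insert W c b ≡ true → update σ c f a ≡ update σ c f b → a ≡ b
  distinct′ a b ha hb eq with insert-cases W c ha | insert-cases W c hb
  ... | inj₁ Wa   | inj₁ Wb   = distinct reps a b Wa Wb (trans (sym (old Wa)) (trans eq (old Wb)))
  ... | inj₁ Wa   | inj₂ refl = ⊥-elim (fresh a Wa (trans (sym (old Wa)) (trans eq (update-here σ c f))))
  ... | inj₂ refl | inj₁ Wb   = ⊥-elim (fresh b Wb (trans (sym (old Wb)) (trans (sym eq) (update-here σ c f))))
  ... | inj₂ refl | inj₂ refl = refl

module Walk {m : ℕ} {E : Set} (node : VSet m) (inc : Fin m → E → Bool)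
  (atMostTwoEnds : ∀ e a b c → inc a e ≡ true → inc b e ≡ true → inc c e ≡ true → a ≢ b → c ≡ a ⊎ c ≡ b)
  (s : Fin m) (node-s : node s ≡ true) (s-edge : Σ E λ f → inc s f ≡ true)
  (anotherEdge : ∀ c → node c ≡ true → c ≢ s → ∀ e → Σ E λ f → inc c f ≡ true × f ≢ e)
  where

  -- Every node incident to an edge already used is assigned, except possibly the other end of
  -- the edge used last. That end, if unassigned, differs from s and so has a second edge, which
  -- is still unused; if there is no such end, the walk restarts at an unassigned node.
  record State : Set where
    field
      assigned      : VSet m
      σ             : Fin m → E
      last          : Fin m
      reps          : DistinctRepresentatives assigned inc σ
      assigned⊆node : assigned ⊆ᵇ node
      s-assigned    : assigned s ≡ true
      closedExcept  : ∀ a b → assigned a ≡ true → a ≢ last → node b ≡ true → inc b (σ a) ≡ true →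
                      assigned b ≡ true
  open State

  Result : Set
  Result = Σ (Fin m → E) (DistinctRepresentatives node inc)

  Progress : State → Set
  Progress w = Σ State λ w′ → size (node ∖ assigned w′) < size (node ∖ assigned w)

  extend : (w : State) {d : Fin m} {f : E} → node d ≡ true → assigned w d ≡ false → inc d f ≡ true →
           (∀ a → assigned w a ≡ true → σ w a ≢ f) →
           (∀ a b → assigned w a ≡ true → node b ≡ true → inc b (σ w a) ≡ true → assigned w b ≡ true ⊎ b ≡ d) →
           Progress w
  extend w {d} {f} nd ¬ad df fresh closedUpTo-d = record
    { assigned      = insert (assigned w) d
    ; σ             = update (σ w) d f
    ; last          = d
    ; reps          = assign (reps w) ¬ad df fresh
    ; assigned⊆node = λ a h → [ assigned⊆node w a , (λ { refl → nd }) ] (insert-cases (assigned w) d h)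
    ; s-assigned    = insert-old (assigned w) d (s-assigned w)
    ; closedExcept  = closedExcept′ }
    , size-insert node (assigned w) nd ¬ad
    where
    closedExcept′ : ∀ a b → insert (assigned w) d a ≡ true → a ≢ d → node b ≡ true →
                    inc b (update (σ w) d f a) ≡ true → insert (assigned w) d b ≡ true
    closedExcept′ a b ha a≢d nb hb with insert-cases (assigned w) d ha
    ... | inj₂ a≡d = ⊥-elim (a≢d a≡d)
    ... | inj₁ aa with closedUpTo-d a b aa nb (subst (λ e → inc b e ≡ true) (update-there (σ w) f a≢d) hb)
    ...   | inj₁ ab   = insert-old (assigned w) d ab
    ...   | inj₂ refl = insert-new (assigned w) d

  start : State
  start = record
    { assigned      = _== s
    ; σ             = λ _ → proj₁ s-edge
    ; last          = s
    ; reps          = record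
        { represents = λ a h → subst (λ x → inc x (proj₁ s-edge) ≡ true) (sym (is-s h)) (proj₂ s-edge)
        ; distinct   = λ a b ha hb _ → trans (is-s ha) (sym (is-s hb)) }
    ; assigned⊆node = λ a h → subst (λ x → node x ≡ true) (sym (is-s h)) node-s
    ; s-assigned    = dec-true (s ≟ s) refl
    ; closedExcept  = λ a b h a≢s → ⊥-elim (a≢s (is-s h)) }
    where
    is-s : ∀ {a} → (a == s) ≡ true → a ≡ s
    is-s {a} = does-sound (a ≟ s)

  unassigned-parts : ∀ (w : State) {c} → (node ∖ assigned w) c ≡ true →
                     node c ≡ true × assigned w c ≡ false × c ≢ s
  unassigned-parts w {c} h = ∧-elimˡ h , ¬ac , λ { refl → true≢false (s-assigned w) ¬ac }
    where
    ¬ac : assigned w c ≡ false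
    ¬ac = not-true (∧-elimʳ {node c} h)

  FullyClosed : State → Set
  FullyClosed w = ∀ a b → assigned w a ≡ true → node b ≡ true → inc b (σ w a) ≡ true → assigned w b ≡ true

  continue : (w : State) {d : Fin m} → (node ∖ assigned w) d ∧ inc d (σ w (last w)) ≡ true → Progress w
  continue w {d} h with unassigned-parts w (∧-elimˡ h)
  ... | nd , ¬ad , d≢s with anotherEdge d nd d≢s (σ w (last w))
  ...   | f , df , f≢e = extend w nd ¬ad df fresh closedUpTo-d
    where
    fresh : ∀ a → assigned w a ≡ true → σ w a ≢ f
    fresh a aa eq with a ≟ last w
    ... | yes refl = f≢e (sym eq)
    ... | no a≢l   = true≢false (closedExcept w a d aa a≢l nd (subst (λ e → inc d e ≡ true) (sym eq) df)) ¬ad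

    closedUpTo-d : ∀ a b → assigned w a ≡ true → node b ≡ true → inc b (σ w a) ≡ true →
                   assigned w b ≡ true ⊎ b ≡ d
    closedUpTo-d a b aa nb ba with a ≟ last w
    ... | no a≢l   = inj₁ (closedExcept w a b aa a≢l nb ba)
    ... | yes refl with atMostTwoEnds (σ w a) a d b (represents (reps w) a aa) (∧-elimʳ {(node ∖ assigned w) d} h) ba
                          (λ { refl → true≢false aa ¬ad })
    ...   | inj₁ refl = inj₁ aa
    ...   | inj₂ b≡d  = inj₂ b≡d

  -- Here anotherEdge is used only to get an edge at c; the edge it avoids is arbitrary.
  restart : (w : State) → FullyClosed w → Result ⊎ Progress w
  restart w closed with any? (λ c → (node ∖ assigned w) c ≟true)
  ... | no allAssigned = inj₁ (σ w , record
    { represents = λ a na → represents (reps w) a (assigned-all na)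
    ; distinct   = λ a b na nb → distinct (reps w) a b (assigned-all na) (assigned-all nb) })
    where
    assigned-all : ∀ {a} → node a ≡ true → assigned w a ≡ true
    assigned-all {a} na with bool-cases (assigned w a)
    ... | inj₁ aa  = aa
    ... | inj₂ ¬aa = ⊥-elim (allAssigned (a , ∧-intro na (not-false ¬aa)))
  ... | yes (c , h) with unassigned-parts w h
  ...   | nc , ¬ac , c≢s with anotherEdge c nc c≢s (proj₁ s-edge)
  ...     | f , cf , _ = inj₂ (extend w nc ¬ac cf fresh (λ a b aa nb ba → inj₁ (closed a b aa nb ba)))
    where
    fresh : ∀ a → assigned w a ≡ true → σ w a ≢ f
    fresh a aa eq = true≢false (closed a c aa nc (subst (λ e → inc c e ≡ true) (sym eq) cf)) ¬ac

  advance : (w : State) → Result ⊎ Progress w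
  advance w with any? (λ d → (node ∖ assigned w) d ∧ inc d (σ w (last w)) ≟true)
  ... | yes (d , h) = inj₂ (continue w h)
  ... | no none     = restart w closed
    where
    closed : FullyClosed w
    closed a b aa nb ba with a ≟ last w | bool-cases (assigned w b)
    ... | _        | inj₁ ab  = ab
    ... | no a≢l   | inj₂ _   = closedExcept w a b aa a≢l nb ba
    ... | yes refl | inj₂ ¬ab = ⊥-elim (none (b , ∧-intro (∧-intro nb (not-false ¬ab)) ba))

  walk : ∀ k (w : State) → size (node ∖ assigned w) ≤ k → Result
  walk k       w bound with advance w
  walk k       w bound | inj₁ result       = result
  walk zero    w bound | inj₂ (w′ , fewer) = ⊥-elim (n≮0 (<-≤-trans fewer bound))
  walk (suc k) w bound | inj₂ (w′ , fewer) = walk k w′ (≤-pred (<-≤-trans fewer bound))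

  distinctRepresentatives : Result
  distinctRepresentatives = walk m start (size≤ _)

atMostTwoEnds-∪ : {E : Set} (P R : Fin m → E → Bool) →
                  (∀ e a c → P a e ≡ true → P c e ≡ true → a ≡ c) →
                  (∀ e a c → R a e ≡ true → R c e ≡ true → a ≡ c) →
                  ∀ e a b c → P a e ∨ R a e ≡ true → P b e ∨ R b e ≡ true → P c e ∨ R c e ≡ true →
                  a ≢ b → c ≡ a ⊎ c ≡ b
atMostTwoEnds-∪ P R P-unique R-unique e a b c ha hb hc a≢b
  with ∨-elim {P a e} ha | ∨-elim {P b e} hb | ∨-elim {P c e} hc
... | inj₁ Pa | _      | inj₁ Pc = inj₁ (P-unique e c a Pc Pa)
... | inj₂ Ra | _      | inj₂ Rc = inj₁ (R-unique e c a Rc Ra)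
... | inj₂ _  | inj₁ Pb | inj₁ Pc = inj₂ (P-unique e c b Pc Pb)
... | inj₁ _  | inj₂ Rb | inj₂ Rc = inj₂ (R-unique e c b Rc Rb)
... | inj₁ Pa | inj₁ Pb | inj₂ _  = ⊥-elim (a≢b (P-unique e a b Pa Pb))
... | inj₂ Ra | inj₂ Rb | inj₁ _  = ⊥-elim (a≢b (R-unique e a b Ra Rb))

-- The good pair

any-witness : {A : Set} (p : A → Bool) (xs : List A) → any p xs ≡ true → ∃ λ x → p x ≡ true
any-witness p xs h = map₂ (Equivalence.to T-≡) (satisfied (any⁻ p xs (Equivalence.from T-≡ h)))

arcInto : (D : Digraph) → VSet (n D) → VSet (n D) → Fin (n D) × Fin (n D) → Bool
arcInto D T C (y , z) = T y ∧ (C z ∧ arc D y z)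

arcInto-cong : (D : Digraph) (T : VSet (n D)) {C C′ : VSet (n D)} → SameSet C C′ →
               ∀ e → arcInto D T C e ≡ arcInto D T C′ e
arcInto-cong D T same (y , z) = cong (λ b → T y ∧ (b ∧ arc D y z)) (same z)

module _ (D : Digraph) (T C : VSet (n D)) where

  arcInto-from : ∀ {y} → NinT D T C y ≡ true → ∃ λ z → arcInto D T C (y , z) ≡ true
  arcInto-from {y} h = map₂ (∧-intro (∧-elimˡ {T y} h)) (any-witness _ (allV (n D)) (∧-elimʳ {T y} h))

  arcInto-exists : din D T C ≥ 1 → ∃ λ e → arcInto D T C e ≡ true
  arcInto-exists h with size-nonempty (NinT D T C) h
  ... | y , Ny with arcInto-from Ny
  ...   | z , e = (y , z) , e

  arcInto-another : din D T C ≥ 2 → ∀ e → ∃ λ f → arcInto D T C f ≡ true × f ≢ e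
  arcInto-another h e with size-twoElements (NinT D T C) h
  ... | y₁ , y₂ , y₁≢y₂ , N₁ , N₂ with arcInto-from N₁ | arcInto-from N₂ | y₁ ≟ proj₁ e
  ...   | z₁ , a₁ | z₂ , a₂ | yes refl = (y₂ , z₂) , a₂ , λ { refl → y₁≢y₂ refl }
  ...   | z₁ , a₁ | z₂ , a₂ | no y₁≢  = (y₁ , z₁) , a₁ , λ { refl → y₁≢ refl }

module Construction (D : Digraph) (Q : Subdigraph D)
  (X∩Y=∅ : ∀ v → ¬ ((Nin D (vQ Q) v ≡ true) × (Nout D (vQ Q) v ≡ true))) where

  private
    V : Set
    V = Fin (n D)

  X Y : VSet (n D)
  X = Nin D (vQ Q)
  Y = Nout D (vQ Q)

  module CX = Components D X
  -- The terminal components of D[Y] are the initial components of (reverse D)[Y].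
  module CY = Components (reverse D) Y

  xNode yNode node : VSet (n D)
  xNode = CX.initialRep
  yNode = CY.initialRep
  node b = xNode b ∨ yNode b

  Arc : Set
  Arc = V × V

  -- An arc y → z from Y to X is incident to the node of the component of z and to that of y.
  enters leaves incident : V → Arc → Bool
  enters b e = xNode b ∧ arcInto D Y (CX.comp b) e
  leaves b e = yNode b ∧ arcInto (reverse D) X (CY.comp b) (swap e)
  incident b e = enters b e ∨ leaves b e

  enters-unique : ∀ e a c → enters a e ≡ true → enters c e ≡ true → a ≡ c
  enters-unique (y , z) a c ha hc = CX.initialRep-unique (∧-elimˡ ha) (∧-elimˡ hc) (into ha) (into hc)
    where
    into : ∀ {b} → enters b (y , z) ≡ true → CX.comp b z ≡ true
    into {b} h = ∧-elimˡ {CX.comp b z} (∧-elimʳ {Y y} (∧-elimʳ {xNode b} h))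

  leaves-unique : ∀ e a c → leaves a e ≡ true → leaves c e ≡ true → a ≡ c
  leaves-unique (w , x) a c ha hc = CY.initialRep-unique (∧-elimˡ ha) (∧-elimˡ hc) (from ha) (from hc)
    where
    from : ∀ {b} → leaves b (w , x) ≡ true → CY.comp b w ≡ true
    from {b} h = ∧-elimˡ {CY.comp b w} (∧-elimʳ {X x} (∧-elimʳ {yNode b} h))

  atMostTwoEnds : ∀ e a b c → incident a e ≡ true → incident b e ≡ true → incident c e ≡ true →
                  a ≢ b → c ≡ a ⊎ c ≡ b
  atMostTwoEnds = atMostTwoEnds-∪ enters leaves enters-unique leaves-unique

  xNode-incident : ∀ {b e} → xNode b ≡ true → incident b e ≡ true → arcInto D Y (CX.comp b) e ≡ true
  xNode-incident {b} {e} xb h with ∨-elim {enters b e} h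
  ... | inj₁ h′ = ∧-elimʳ {xNode b} h′
  ... | inj₂ h′ = ⊥-elim (X∩Y=∅ b (CX.initialRep-∈ xb , CY.initialRep-∈ (∧-elimˡ h′)))

  yNode-incident : ∀ {b e} → yNode b ≡ true → incident b e ≡ true →
                   arcInto (reverse D) X (CY.comp b) (swap e) ≡ true
  yNode-incident {b} {e} yb h with ∨-elim {enters b e} h
  ... | inj₂ h′ = ∧-elimʳ {yNode b} h′
  ... | inj₁ h′ = ⊥-elim (X∩Y=∅ b (CX.initialRep-∈ (∧-elimˡ h′) , CY.initialRep-∈ yb))

  xNode-another : ∀ {b} → xNode b ≡ true → din D Y (CX.comp b) ≥ 2 →
                  ∀ e → Σ Arc λ f → incident b f ≡ true × f ≢ e
  xNode-another {b} xb deg e =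
    let f , h , f≢e = arcInto-another D Y (CX.comp b) deg e
    in  f , ∨-introˡ (leaves b f) (∧-intro xb h) , f≢e

  yNode-another : ∀ {b} → yNode b ≡ true → dout D X (CY.comp b) ≥ 2 →
                  ∀ e → Σ Arc λ f → incident b f ≡ true × f ≢ e
  yNode-another {b} yb deg e =
    let f , h , f≢e = arcInto-another (reverse D) X (CY.comp b) deg (swap e)
    in  swap f , ∨-introʳ (enters b (swap f)) (∧-intro yb h) , λ eq → f≢e (cong swap eq)

  yNode⇒terminal : ∀ {b} → yNode b ≡ true → TerminalSC D Y (CY.comp b)
  yNode⇒terminal yb = initial-reverse⇒terminal D Y (CY.initialRep⇒initial yb)

  Representatives : Set
  Representatives = Σ (V → Arc) (DistinctRepresentatives node incident)

  representatives₁ : (Σ (VSet (n D)) λ X₁ → InitialSC D X X₁ × din D Y X₁ ≥ 1 ×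
                        (∀ Xi → InitialSC D X Xi → ¬ SameSet Xi X₁ → din D Y Xi ≥ 2) ×
                        (∀ Yj → TerminalSC D Y Yj → dout D X Yj ≥ 2)) → Representatives
  representatives₁ (X₁ , initial₁ , deg₁ , degX , degY) =
    let s , xs , same = CX.initialRep-of initial₁
    in  Walk.distinctRepresentatives node incident atMostTwoEnds s (∨-introˡ (yNode s) xs) (s-edge xs same) (another xs same)
    where
    s-edge : ∀ {s} → xNode s ≡ true → SameSet (CX.comp s) X₁ → Σ Arc λ f → incident s f ≡ true
    s-edge {s} xs same =
      let e , h = arcInto-exists D Y X₁ deg₁
      in  e , ∨-introˡ (leaves s e) (∧-intro xs (trans (arcInto-cong D Y same e) h))

    another : ∀ {s} → xNode s ≡ true → SameSet (CX.comp s) X₁ →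
              ∀ c → node c ≡ true → c ≢ s → ∀ e → Σ Arc λ f → incident c f ≡ true × f ≢ e
    another xs same c nc c≢s =
      [ (λ xc → xNode-another xc (degX (CX.comp c) (CX.initialRep⇒initial xc) λ same′ →
                  c≢s (CX.initialRep-sameSet xc xs λ w → trans (same′ w) (sym (same w)))))
      , (λ yc → yNode-another yc (degY (CY.comp c) (yNode⇒terminal yc)))
      ] (∨-elim {xNode c} nc)

  representatives₂ : (Σ (VSet (n D)) λ Y₁ → TerminalSC D Y Y₁ × dout D X Y₁ ≥ 1 ×
                        (∀ Yj → TerminalSC D Y Yj → ¬ SameSet Yj Y₁ → dout D X Yj ≥ 2) ×
                        (∀ Xi → InitialSC D X Xi → din D Y Xi ≥ 2)) → Representatives
  representatives₂ (Y₁ , terminal₁ , deg₁ , degY , degX) =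
    let s , ys , same = CY.initialRep-of (terminal⇒initial-reverse D Y terminal₁)
    in  Walk.distinctRepresentatives node incident atMostTwoEnds s (∨-introʳ (xNode s) ys) (s-edge ys same) (another ys same)
    where
    s-edge : ∀ {s} → yNode s ≡ true → SameSet (CY.comp s) Y₁ → Σ Arc λ f → incident s f ≡ true
    s-edge {s} ys same =
      let e , h = arcInto-exists (reverse D) X Y₁ deg₁
      in  swap e , ∨-introʳ (enters s (swap e)) (∧-intro ys (trans (arcInto-cong (reverse D) X same e) h))

    another : ∀ {s} → yNode s ≡ true → SameSet (CY.comp s) Y₁ →
              ∀ c → node c ≡ true → c ≢ s → ∀ e → Σ Arc λ f → incident c f ≡ true × f ≢ e
    another ys same c nc c≢s =
      [ (λ xc → xNode-another xc (degX (CX.comp c) (CX.initialRep⇒initial xc)))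
      , (λ yc → yNode-another yc (degY (CY.comp c) (yNode⇒terminal yc) λ same′ →
                  c≢s (CY.initialRep-sameSet yc ys λ w → trans (same′ w) (sym (same w)))))
      ] (∨-elim {xNode c} nc)

  module FromRepresentatives (goodQ : SubdigraphHasGoodPair Q)
    (covered : ∀ v → vQ Q v ≡ false → X v ≡ true ⊎ Y v ≡ true)
    (σ : V → Arc) (reps : DistinctRepresentatives node incident σ) where

    T⁺Q T⁻Q : ASet (n D)
    T⁺Q = proj₁ goodQ
    T⁻Q = proj₁ (proj₂ goodQ)

    outQ : OutBranching (vQ Q) (aQ Q) T⁺Q
    outQ = proj₁ (proj₂ (proj₂ goodQ))

    inQ : InBranching (vQ Q) (aQ Q) T⁻Q
    inQ = proj₁ (proj₂ (proj₂ (proj₂ goodQ)))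

    T⁺Q∩T⁻Q=∅ : ∀ u v → T⁺Q u v ≡ true → T⁻Q u v ≡ false
    T⁺Q∩T⁻Q=∅ = proj₂ (proj₂ (proj₂ (proj₂ goodQ)))

    -- The arcs assigned to Y-nodes go to A⁻, the other arcs from Y to X to A⁺.
    chosen? : (u v : V) → Dec (∃ λ c → yNode c ≡ true × σ c ≡ (u , v))
    chosen? u v = any? (λ c → yNode c ≟true ×-dec Productₚ.≡-dec _≟_ _≟_ (σ c) (u , v))

    chosen : ASet (n D)
    chosen u v = does (chosen? u v)

    chosen-arc : ∀ {u v} → chosen u v ≡ true → Y u ≡ true × X v ≡ true × arc D u v ≡ true
    chosen-arc {u} {v} h with does-sound (chosen? u v) h
    ... | c , yc , σc≡uv with yNode-incident yc (represents reps c (∨-introʳ (xNode c) yc))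
    ...   | leaving rewrite σc≡uv =
            let Xv , cu , uv = ∧₃-elim (X v) (CY.comp c u) leaving in ∧-elimˡ cu , Xv , uv

    yNode-chosen : ∀ {b} → yNode b ≡ true → chosen (proj₁ (σ b)) (proj₂ (σ b)) ≡ true
    yNode-chosen {b} yb = dec-true (chosen? _ _) (b , yb , refl)

    xNode-unchosen : ∀ {b} → xNode b ≡ true → chosen (proj₁ (σ b)) (proj₂ (σ b)) ≡ false
    xNode-unchosen {b} xb = dec-false (chosen? _ _) λ (c , yc , σc≡σb) →
      let c≡b = distinct reps c b (∨-introʳ (xNode c) yc) (∨-introˡ (yNode b) xb) σc≡σb
      in  X∩Y=∅ b (CX.initialRep-∈ xb , CY.initialRep-∈ (subst (λ a → yNode a ≡ true) c≡b yc))

    A⁺-Arc A⁻-Arc : V → V → Set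
    A⁺-Arc u v = T⁺Q u v ≡ true
               ⊎ (vQ Q u ≡ true × Y v ≡ true × arc D u v ≡ true)
               ⊎ (X u ≡ true × X v ≡ true × arc D u v ≡ true)
               ⊎ (Y u ≡ true × X v ≡ true × arc D u v ≡ true × chosen u v ≡ false)
    A⁻-Arc u v = T⁻Q u v ≡ true
               ⊎ (X u ≡ true × vQ Q v ≡ true × arc D u v ≡ true)
               ⊎ (Y u ≡ true × Y v ≡ true × arc D u v ≡ true)
               ⊎ chosen u v ≡ true

    pattern tree⁺ t          = inj₁ t
    pattern Q→Y q y a        = inj₂ (inj₁ (q , y , a))
    pattern X→X x x′ a       = inj₂ (inj₂ (inj₁ (x , x′ , a)))
    pattern unchosen y x a c = inj₂ (inj₂ (inj₂ (y , x , a , c)))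
    pattern tree⁻ t          = inj₁ t
    pattern X→Q x q a        = inj₂ (inj₁ (x , q , a))
    pattern Y→Y y y′ a       = inj₂ (inj₂ (inj₁ (y , y′ , a)))
    pattern chosenArc c      = inj₂ (inj₂ (inj₂ c))

    A⁺? : ∀ u v → Dec (A⁺-Arc u v)
    A⁺? u v = T⁺Q u v ≟true
              ⊎-dec (vQ Q u ≟true ×-dec Y v ≟true ×-dec arc D u v ≟true)
              ⊎-dec (X u ≟true ×-dec X v ≟true ×-dec arc D u v ≟true)
              ⊎-dec (Y u ≟true ×-dec X v ≟true ×-dec arc D u v ≟true ×-dec chosen u v Bool.≟ false)

    A⁻? : ∀ u v → Dec (A⁻-Arc u v)
    A⁻? u v = T⁻Q u v ≟true
              ⊎-dec (X u ≟true ×-dec vQ Q v ≟true ×-dec arc D u v ≟true)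
              ⊎-dec (Y u ≟true ×-dec Y v ≟true ×-dec arc D u v ≟true)
              ⊎-dec chosen u v ≟true

    A⁺ A⁻ : ASet (n D)
    A⁺ u v = does (A⁺? u v)
    A⁻ u v = does (A⁻? u v)

    A⁺-view : ∀ {u v} → A⁺ u v ≡ true → A⁺-Arc u v
    A⁺-view {u} {v} = does-sound (A⁺? u v)

    A⁻-view : ∀ {u v} → A⁻ u v ≡ true → A⁻-Arc u v
    A⁻-view {u} {v} = does-sound (A⁻? u v)

    A⁺-intro : ∀ {u v} → A⁺-Arc u v → A⁺ u v ≡ true
    A⁺-intro {u} {v} = dec-true (A⁺? u v)

    A⁻-intro : ∀ {u v} → A⁻-Arc u v → A⁻ u v ≡ true
    A⁻-intro {u} {v} = dec-true (A⁻? u v)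

    tree⁺-arc : ∀ {u v} → T⁺Q u v ≡ true → aQ Q u v ≡ true
    tree⁺-arc {u} {v} = OutBranching.T⊆B outQ u v

    tree⁻-arc : ∀ {u v} → T⁻Q u v ≡ true → aQ Q u v ≡ true
    tree⁻-arc {u} {v} = OutBranching.T⊆B inQ v u

    A⁺⊆D : ∀ u v → A⁺ u v ≡ true → arc D u v ≡ true
    A⁺⊆D u v h with A⁺-view h
    ... | tree⁺ t          = aQ⊆ Q u v (tree⁺-arc t)
    ... | Q→Y _ _ a        = a
    ... | X→X _ _ a        = a
    ... | unchosen _ _ a _ = a

    A⁻⊆D : ∀ u v → A⁻ u v ≡ true → arc D u v ≡ true
    A⁻⊆D u v h with A⁻-view h
    ... | tree⁻ t     = aQ⊆ Q u v (tree⁻-arc t)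
    ... | X→Q _ _ a   = a
    ... | Y→Y _ _ a   = a
    ... | chosenArc c = proj₂ (proj₂ (chosen-arc c))

    Q∩X=∅ : ∀ {v} → vQ Q v ≡ true → X v ≢ true
    Q∩X=∅ q x = true≢false q (not-true (∧-elimˡ x))

    Q∩Y=∅ : ∀ {v} → vQ Q v ≡ true → Y v ≢ true
    Q∩Y=∅ q y = true≢false q (not-true (∧-elimˡ y))

    -- Q, X and Y are pairwise disjoint and T⁺Q, T⁻Q are arc-disjoint; chosen arcs were removed from A⁺.
    A⁺∩A⁻=∅ : ∀ u v → A⁺ u v ≡ true → A⁻ u v ≢ true
    A⁺∩A⁻=∅ u v h⁺ h⁻ with A⁺-view h⁺ | A⁻-view h⁻
    ... | tree⁺ t          | tree⁻ t′     = true≢false t′ (T⁺Q∩T⁻Q=∅ u v t)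
    ... | tree⁺ t          | X→Q x _ _    = Q∩X=∅ (proj₁ (aQ-ends Q u v (tree⁺-arc t))) x
    ... | tree⁺ t          | Y→Y y _ _    = Q∩Y=∅ (proj₁ (aQ-ends Q u v (tree⁺-arc t))) y
    ... | tree⁺ t          | chosenArc c  = Q∩Y=∅ (proj₁ (aQ-ends Q u v (tree⁺-arc t))) (proj₁ (chosen-arc c))
    ... | Q→Y _ y _        | tree⁻ t      = Q∩Y=∅ (proj₂ (aQ-ends Q u v (tree⁻-arc t))) y
    ... | Q→Y q _ _        | X→Q x _ _    = Q∩X=∅ q x
    ... | Q→Y q _ _        | Y→Y y _ _    = Q∩Y=∅ q y
    ... | Q→Y q _ _        | chosenArc c  = Q∩Y=∅ q (proj₁ (chosen-arc c))
    ... | X→X x _ _        | tree⁻ t      = Q∩X=∅ (proj₁ (aQ-ends Q u v (tree⁻-arc t))) x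
    ... | X→X _ x _        | X→Q _ q _    = Q∩X=∅ q x
    ... | X→X x _ _        | Y→Y y _ _    = X∩Y=∅ u (x , y)
    ... | X→X x _ _        | chosenArc c  = X∩Y=∅ u (x , proj₁ (chosen-arc c))
    ... | unchosen y _ _ _ | tree⁻ t      = Q∩Y=∅ (proj₁ (aQ-ends Q u v (tree⁻-arc t))) y
    ... | unchosen y _ _ _ | X→Q x _ _    = X∩Y=∅ u (x , y)
    ... | unchosen _ x _ _ | Y→Y _ y _    = X∩Y=∅ v (x , y)
    ... | unchosen _ _ _ c | chosenArc c′ = true≢false c′ c

    r⁺ r⁻ : V
    r⁺ = OutBranching.root outQ
    r⁻ = OutBranching.root inQ

    reach⁺-Q : ∀ {q} → vQ Q q ≡ true → Reach A⁺ r⁺ q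
    reach⁺-Q {q} h = reach-mono (λ _ _ t → A⁺-intro (tree⁺ t)) (OutBranching.reach outQ q h)

    reach⁻-Q : ∀ {q} → vQ Q q ≡ true → Reach A⁻ q r⁻
    reach⁻-Q {q} h = reach-mono (λ _ _ t → A⁻-intro (tree⁻ t)) (reach-rev (OutBranching.reach inQ q h))

    reach⁺-Y : ∀ {y} → Y y ≡ true → Reach A⁺ r⁺ y
    reach⁺-Y {y} yy with any-witness _ (allV (n D)) (∧-elimʳ {not (vQ Q y)} yy)
    ... | q , h = reach-snoc (reach⁺-Q (∧-elimˡ h)) (A⁺-intro (Q→Y (∧-elimˡ h) yy (∧-elimʳ {vQ Q q} h)))

    reach⁻-X : ∀ {x} → X x ≡ true → Reach A⁻ x r⁻
    reach⁻-X {x} xx with any-witness _ (allV (n D)) (∧-elimʳ {not (vQ Q x)} xx)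
    ... | q , h = step (A⁻-intro (X→Q xx (∧-elimˡ h) (∧-elimʳ {vQ Q q} h))) (reach⁻-Q (∧-elimˡ h))

    induced-X⊆A⁺ : ∀ a c → induced D X a c ≡ true → A⁺ a c ≡ true
    induced-X⊆A⁺ a c h = let Xa , Xc , ac = ∧₃-elim (X a) (X c) h in A⁺-intro (X→X Xa Xc ac)

    induced-Y⊆A⁻ : ∀ a c → induced D Y a c ≡ true → A⁻ a c ≡ true
    induced-Y⊆A⁻ a c h = let Ya , Yc , ac = ∧₃-elim (Y a) (Y c) h in A⁻-intro (Y→Y Ya Yc ac)

    -- x is reached in D[X] from the component of an X-node b, which is entered by the arc σ b.
    reach⁺-X : ∀ {x} → X x ≡ true → Reach A⁺ r⁺ x
    reach⁺-X xx =
      let b , xb , into = CX.reachedFromInitialRep xx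
          y , z         = σ b
          yy , bz , yz  = ∧₃-elim (Y y) (CX.comp b z) (xNode-incident xb (represents reps b (∨-introˡ (yNode b) xb)))
      in  reach-trans (reach-snoc (reach⁺-Y yy) (A⁺-intro (unchosen yy (∧-elimˡ bz) yz (xNode-unchosen xb))))
                      (reach-mono induced-X⊆A⁺ (into z bz))

    -- y reaches in D[Y] the component of a Y-node b, which is left by the arc σ b.
    reach⁻-Y : ∀ {y} → Y y ≡ true → Reach A⁻ y r⁻
    reach⁻-Y yy =
      let b , yb , into = CY.reachedFromInitialRep yy
          w , x         = σ b
          xx , bw , wx  = ∧₃-elim (X x) (CY.comp b w) (yNode-incident yb (represents reps b (∨-introʳ (xNode b) yb)))
      in  reach-trans (reach-mono induced-Y⊆A⁻ (reach-reverse (reverse D) Y (into w bw)))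
                      (step (A⁻-intro (chosenArc (yNode-chosen yb))) (reach⁻-X xx))

    reach⁺ : ∀ v → Reach A⁺ r⁺ v
    reach⁺ v = [ reach⁺-Q , (λ ¬q → [ reach⁺-X , reach⁺-Y ]′ (covered v ¬q)) ]′ (bool-cases (vQ Q v))

    reach⁻ : ∀ v → Reach A⁻ v r⁻
    reach⁻ v = [ reach⁻-Q , (λ ¬q → [ reach⁻-X , reach⁻-Y ]′ (covered v ¬q)) ]′ (bool-cases (vQ Q v))

    goodPair : DigraphHasGoodPair D
    goodPair = arcDisjointReach⇒goodPair A⁺ A⁻ A⁺⊆D A⁻⊆D A⁺∩A⁻=∅ reach⁺ reach⁻

proposition2 : (D : Digraph) (Q : Subdigraph D) →
  SubdigraphHasGoodPair Q →
  let X = Nin D (vQ Q)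
      Y = Nout D (vQ Q)
  in (∀ v → ¬ ((X v ≡ true) × (Y v ≡ true))) →
     (∀ v → vQ Q v ≡ false → (X v ≡ true) ⊎ (Y v ≡ true)) →
     ((Σ (VSet (n D)) λ X₁ → InitialSC D X X₁ × din D Y X₁ ≥ 1 ×
         (∀ Xi → InitialSC D X Xi → ¬ SameSet Xi X₁ → din D Y Xi ≥ 2) ×
         (∀ Yj → TerminalSC D Y Yj → dout D X Yj ≥ 2))
      ⊎
      (Σ (VSet (n D)) λ Y₁ → TerminalSC D Y Y₁ × dout D X Y₁ ≥ 1 ×
         (∀ Yj → TerminalSC D Y Yj → ¬ SameSet Yj Y₁ → dout D X Yj ≥ 2) ×
         (∀ Xi → InitialSC D X Xi → din D Y Xi ≥ 2))) →
     DigraphHasGoodPair D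
proposition2 D Q goodQ X∩Y=∅ covered condition =
  FromRepresentatives.goodPair goodQ covered (proj₁ representatives) (proj₂ representatives)
  where
  open Construction D Q X∩Y=∅
  representatives : Representatives
  representatives = [ representatives₁ , representatives₂ ]′ condition
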